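{- For all $m,n\in\omega$, all sets of statements $\Gamma,\Delta$ and all $S,P\in\mathsf{T}$: if $\Gamma\vdash_m X$ for every $X\in\Delta$ and $\Delta\vdash_n(S:P)$, then $\Gamma\vdash_{m+n}(S:P)$.
   Context: Terms: constants $\mathsf{C}=\{\mathsf{c},\mathsf{c}',\dots\}$, variables $\mathsf{V}=\{\mathsf{v},\mathsf{v}',\dots\}$; $\mathsf{T}$ is the smallest set of strings containing $\mathsf{C}\cup\mathsf{V}$ and $\rho S$, $\beta RS$, $\lambda xRS$ for $R,S\in\mathsf{T}$, $x\in\mathsf{V}$; write $FS$ for $\beta FS$ and $\pi xPR$ for $\rho\lambda xPR$. Free variables: $\mathsf{F}(a)=\emptyset$ for constants, $\mathsf{F}(x)=\{x\}$, $\mathsf{F}(\rho R)=\mathsf{F}(R)$, $\mathsf{F}(\beta RS)=\mathsf{F}(R)\cup\mathsf{F}(S)$, $\mathsf{F}(\lambda xRS)=\mathsf{F}(R)\cup(\mathsf{F}(S)\setminus\{x\})$. Substitution: for $t\in\mathsf{C}\cup\mathsf{V}$, $t_{[T/x]}=T$ if $t=x$, else $t$; $(\rho R)_{[T/x]}=\rho R_{[T/x]}$; $(\beta RS)_{[T/x]}=\beta R_{[T/x]}S_{[T/x]}$; $(\lambda yRS)_{[T/x]}=\lambda yR_{[T/x]}S$ if $y=x$ or $x\notin\mathsf{F}(S)$, otherwise $\lambda zR_{[T/x]}S_{[z/y][T/x]}$ with $z\notin\mathsf{F}(T)\cup(\mathsf{F}(S)\setminus\{y\})$ and $z=y$ whenever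 $y\notin\mathsf{F}(T)$. $\alpha$-equivalence: $\mathsf{B}(T)=\{x\in\mathsf{V}\mid\lambda x\text{ is a substring of }T\}$, $\mathsf{V}(T)=\mathsf{F}(T)\cup\mathsf{B}(T)$; $\equiv_\alpha$ is the reflexive transitive closure of the relation replacing one subterm occurrence $\lambda xRS$ by $\lambda yRS_{[y/x]}$ with $x\notin\mathsf{B}(S)$, $y\notin\mathsf{V}(S)$ (an equivalence relation). A statement $(S:P)$ is the pair of $\equiv_\alpha$-classes of $S$ and $P$. $\mathsf{F}(\Gamma)=\bigcup_{(S:P)\in\Gamma}(\mathsf{F}(S)\cup\mathsf{F}(P))$. A relation $\Vdash$ between sets of statements and statements is monotone if $\Gamma\supseteq\Delta\Vdash X$ implies $\Gamma\Vdash X$, and reflexive if $\{X\}\Vdash X$. Define $\Gamma\vdash_0 X$ iff $X\in\Gamma$. Given $\vdash_n$, let $\vdash_{n+1}$ be the smallest monotone reflexive relation such that for all sets $\Gamma$ of statements, $F,P,Q,R,S\in\mathsf{T}$, $x\in\mathsf{V}$ and $y\in\mathsf{V}\setminus(\mathsf{F}(\Gamma)\cup\mathsf{F}(Q))$: if $\Gamma\vdash_n(F:\pi xPR)$ and $\Gamma\vdash_n(S:P)$ then $\Gamma\vdash_{n+1}(FS:R_{[S/x]})$; and if $\Gamma\cup\{(y:Q)\}\vdash_n(S:P)$ then $\Gamma\vdash_{n+1}(\lambda yQS:\pi yQP)$. -}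

module Defs where

open import Data.Nat using (ℕ; zero; suc; _+_; _⊔_)
open import Data.Nat.Properties using (_≟_)
open import Data.List using (List; []; _∷_; _++_; filter; foldr)
open import Data.List.Membership.Propositional using (_∈_; _∉_)
open import Data.List.Membership.DecPropositional _≟_ using (_∈?_)
open import Data.Product using (_×_; _,_; Σ; ∃)
open import Data.Sum using (_⊎_)
open import Level using (Lift)
open import Relation.Nullary using (yes; no; ¬_; ¬?)
open import Relation.Binary.PropositionalEquality using (_≡_)
open import Relation.Binary.Construct.Closure.ReflexiveTransitive using (Star)

Const : Set
Const = ℕ

Var : Set
Var = ℕ

-- Terms.  The paper's strings are in Polish notation (ρ S, β R S,
-- λ x R S), which is uniquely readable, so they are exactly the
-- elements of this inductive type.

data Term : Set where
  con : Const → Term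
  var : Var → Term
  ρ   : Term → Term
  β   : Term → Term → Term
  lam : Var → Term → Term → Term

π : Var → Term → Term → Term
π x P R = ρ (lam x P R)

FV : Term → List Var
FV (con c)     = []
FV (var x)     = x ∷ []
FV (ρ R)       = FV R
FV (β R S)     = FV R ++ FV S
FV (lam x R S) = FV R ++ filter (λ v → ¬? (v ≟ x)) (FV S)

BV : Term → List Var
BV (con c)     = []
BV (var x)     = []
BV (ρ R)       = BV R
BV (β R S)     = BV R ++ BV S
BV (lam x R S) = x ∷ (BV R ++ BV S)

AllV : Term → List Var
AllV T = FV T ++ BV T

-- The paper leaves the fresh z free (subject to z ∉ F(T) ∪ (F(S)∖{y}),
-- and z = y whenever y ∉ F(T)); we fix the choice
--   z = y                                  if y ∉ F(T),
--   z = 1 + max (F(T) ++ F(S))             otherwise.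
-- The nested clause S_[z/y][T/x] is not structurally recursive, so we
-- recurse on a fuel argument; `sub` supplies fuel = size S, which is
-- always sufficient (renaming by a variable preserves size).

size : Term → ℕ
size (con c)     = 1
size (var x)     = 1
size (ρ R)       = suc (size R)
size (β R S)     = suc (size R + size S)
size (lam x R S) = suc (size R + size S)

maxList : List ℕ → ℕ
maxList = foldr _⊔_ 0

subF : ℕ → Term → Term → Var → Term
subF zero    S           T x = S
subF (suc k) (con c)     T x = con c
subF (suc k) (var v)     T x with v ≟ x
... | yes _ = T
... | no  _ = var v
subF (suc k) (ρ R)       T x = ρ (subF k R T x)
subF (suc k) (β R S)     T x = β (subF k R T x) (subF k S T x)
subF (suc k) (lam y R S) T x with y ≟ x | x ∈? FV S
... | yes _ | _     = lam y (subF k R T x) S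
... | no _  | no _  = lam y (subF k R T x) S
... | no _  | yes _ = lam z (subF k R T x) (subF k (subF k S (var z) y) T x)
  where
  z : Var
  z with y ∈? FV T
  ... | yes _ = suc (maxList (FV T ++ FV S))
  ... | no  _ = y

_[_/_] : Term → Term → Var → Term
S [ T / x ] = subF (size S) S T x

data _⟶α_ : Term → Term → Set where
  rename : ∀ {x y R S} → x ∉ BV S → y ∉ AllV S →
           lam x R S ⟶α lam y R (S [ var y / x ])
  ρ-cong : ∀ {R R'} → R ⟶α R' → ρ R ⟶α ρ R'
  β-congˡ : ∀ {R R' S} → R ⟶α R' → β R S ⟶α β R' S
  β-congʳ : ∀ {R S S'} → S ⟶α S' → β R S ⟶α β R S'
  lam-congˡ : ∀ {x R R' S} → R ⟶α R' → lam x R S ⟶α lam x R' S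
  lam-congʳ : ∀ {x R S S'} → S ⟶α S' → lam x R S ⟶α lam x R S'

_≡α_ : Term → Term → Set
_≡α_ = Star _⟶α_

-- Statements (S : P).  A statement is a pair of α-classes; we work with
-- representative pairs and make every notion below α-invariant.

Stmt : Set
Stmt = Term × Term

_≈ₛ_ : Stmt → Stmt → Set
(S , P) ≈ₛ (S' , P') = (S ≡α S') × (P ≡α P')

-- A set of statements is given by a predicate on representatives;
-- it denotes the set of α-classes of the pairs satisfying it.
Ctx : Set₁
Ctx = Stmt → Set

_∈ₛ_ : Stmt → Ctx → Set
X ∈ₛ Γ = ∃ λ Y → Γ Y × (Y ≈ₛ X)

_⊆ₛ_ : Ctx → Ctx → Set
Δ ⊆ₛ Γ = ∀ X → X ∈ₛ Δ → X ∈ₛ Γ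

⟦_⟧ : Stmt → Ctx
⟦ X ⟧ Y = Y ≡ X

_,,_ : Ctx → Stmt → Ctx
(Γ ,, X) Y = Γ Y ⊎ (Y ≡ X)

_∉FΓ_ : Var → Ctx → Set
y ∉FΓ Γ = ∀ S P → Γ (S , P) → (y ∉ FV S) × (y ∉ FV P)

-- ⊢_{n+1} from ⊢_n: the smallest monotone, reflexive relation (on
-- α-classes, hence closed under α-conversion of the conclusion) closed
-- under the application and abstraction rules with premises in ⊢_n.

data Step (Prev : Ctx → Stmt → Set₁) : Ctx → Stmt → Set₁ where
  mono : ∀ {Γ Δ X} → Δ ⊆ₛ Γ → Step Prev Δ X → Step Prev Γ X
  refl' : ∀ {X} → Step Prev ⟦ X ⟧ X
  conv : ∀ {Γ X Y} → X ≈ₛ Y → Step Prev Γ X → Step Prev Γ Y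
  app : ∀ {Γ F P R S x} →
        Prev Γ (F , π x P R) → Prev Γ (S , P) →
        Step Prev Γ (β F S , R [ S / x ])
  abs : ∀ {Γ Q S P y} →
        y ∉FΓ Γ → y ∉ FV Q →
        Prev (Γ ,, (var y , Q)) (S , P) →
        Step Prev Γ (lam y Q S , π y Q P)

_⊢[_]_ : Ctx → ℕ → Stmt → Set₁
Γ ⊢[ zero ]  X = Lift _ (X ∈ₛ Γ)
Γ ⊢[ suc n ] X = Step (λ Δ Y → Δ ⊢[ n ] Y) Γ X

{-# OPTIONS --safe #-}
module Submission where

-- Induction on the derivation of Δ ⊢ₙ (S : P), replacing each hypothesis from Δ by its derivation
-- from Γ at level m; since a rule at level k + 1 only looks at level k, levels add up. The one
-- delicate rule is abstraction, whose variable y is fresh for Δ but perhaps not for Γ. Derivations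
-- are finitary: the premise uses finitely many hypotheses of Δ, each derived from finitely many
-- hypotheses of Γ. Renaming y in the premise to a variable w fresh for all of them (renaming a
-- variable preserves derivability at the same level) lets the induction hypothesis apply, and the
-- conclusion is recovered up to α-conversion. The α-equivalences needed for renaming are obtained
-- from a nameless semantics: two terms are α-equivalent iff their de Bruijn-level forms coincide.

open import Defs
open import Data.Nat using (ℕ; zero; suc; _+_; _⊔_; _≤_; _<_; s≤s; _≤′_; ≤′-refl; ≤′-step)
open import Data.Nat.Properties
  using (_≟_; ≤-trans; ≤-refl; ≤-reflexive; <-irrefl; <-≤-trans; <⇒≤; <⇒≢; ≤⇒≤′; n≤1+n; n<1+n;
         m<n⇒m≤1+n; m<n⇒m<1+n; m≤m+n; m≤n+m; m+n≤o⇒m≤o; m+n≤o⇒n≤o; +-comm; +-cancelˡ-≡;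
         +-monoʳ-≤; +-monoʳ-<; m≤m⊔n; m≤n⊔m; m⊔n≤o⇒m≤o; m⊔n≤o⇒n≤o; m<n⇒m<n⊔o; m<n⇒m<o⊔n)
open import Data.List using (List; []; _∷_; _++_)
open import Data.List.Membership.Propositional using (_∈_; _∉_)
open import Data.List.Membership.Propositional.Properties
  using (∈-++⁺ˡ; ∈-++⁺ʳ; ∈-++⁻; ∈-filter⁺; ∈-filter⁻)
open import Data.List.Membership.DecPropositional _≟_ using (_∈?_)
open import Data.List.Relation.Unary.Any using (here; there)
open import Data.List.Relation.Unary.All as All using (All; []; _∷_)
import Data.List.Relation.Unary.All.Properties as All
open import Data.Product using (_×_; _,_; Σ-syntax; proj₁; proj₂)
open import Data.Sum as Sum using (_⊎_; inj₁; inj₂; [_,_]′)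
open import Data.Empty using (⊥; ⊥-elim)
open import Function using (_∘_)
open import Level using (lift)
open import Relation.Nullary using (yes; no; ¬?; contradiction)
open import Relation.Binary.PropositionalEquality
open import Relation.Binary.Construct.Closure.ReflexiveTransitive using (ε; _◅_; _◅◅_; gmap)

FV-β⁺ˡ : ∀ {v} R S → v ∈ FV R → v ∈ FV (β R S)
FV-β⁺ˡ R S = ∈-++⁺ˡ

FV-β⁺ʳ : ∀ {v} R S → v ∈ FV S → v ∈ FV (β R S)
FV-β⁺ʳ R S = ∈-++⁺ʳ (FV R)

FV-β⁻ : ∀ {v} R S → v ∈ FV (β R S) → v ∈ FV R ⊎ v ∈ FV S
FV-β⁻ R S = ∈-++⁻ (FV R)

FV-lam⁺ˡ : ∀ {v} x R S → v ∈ FV R → v ∈ FV (lam x R S)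
FV-lam⁺ˡ x R S = ∈-++⁺ˡ

FV-lam⁺ʳ : ∀ {v} x R S → v ∈ FV S → v ≢ x → v ∈ FV (lam x R S)
FV-lam⁺ʳ x R S v∈S v≢x = ∈-++⁺ʳ (FV R) (∈-filter⁺ (λ v → ¬? (v ≟ x)) v∈S v≢x)

FV-lam⁻ : ∀ {v} x R S → v ∈ FV (lam x R S) → v ∈ FV R ⊎ (v ∈ FV S × v ≢ x)
FV-lam⁻ x R S v∈ with ∈-++⁻ (FV R) v∈
... | inj₁ v∈R = inj₁ v∈R
... | inj₂ v∈S = inj₂ (∈-filter⁻ (λ v → ¬? (v ≟ x)) v∈S)

fresh : List Var → Var
fresh vs = suc (maxList vs)

∈⇒<fresh : ∀ {v} vs → v ∈ vs → v < fresh vs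
∈⇒<fresh (u ∷ vs) (here refl) = s≤s (m≤m⊔n u (maxList vs))
∈⇒<fresh (u ∷ vs) (there v∈vs) = ≤-trans (∈⇒<fresh vs v∈vs) (s≤s (m≤n⊔m u (maxList vs)))

fresh-∉ : ∀ vs → fresh vs ∉ vs
fresh-∉ vs w∈vs = <-irrefl refl (∈⇒<fresh vs w∈vs)

fresh-≢ : ∀ {v} vs → v ∈ vs → fresh vs ≢ v
fresh-≢ vs v∈vs refl = fresh-∉ vs v∈vs

data SubFVar (v : Var) (T : Term) (x : Var) : Term → Set where
  hit  : v ≡ x → SubFVar v T x T
  miss : v ≢ x → SubFVar v T x (var v)

subF-var-view : ∀ k v T x → SubFVar v T x (subF (suc k) (var v) T x)
subF-var-view k v T x with v ≟ x
... | yes v≡x = hit v≡x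
... | no  v≢x = miss v≢x

-- `renamed` is the capture-avoiding clause; its fields are all that is used of the choice of z.
data SubFLam (k : ℕ) (y : Var) (R S T : Term) (x : Var) : Term → Set where
  shadowed : y ≡ x → SubFLam k y R S T x (lam y (subF k R T x) S)
  vacuous  : y ≢ x → x ∉ FV S → SubFLam k y R S T x (lam y (subF k R T x) S)
  renamed  : ∀ z → y ≢ x → x ∈ FV S → z ∉ FV T → (∀ {v} → v ∈ FV S → v ≢ y → v ≢ z) →
             (y ∉ FV T → z ≡ y) →
             SubFLam k y R S T x (lam z (subF k R T x) (subF k (subF k S (var z) y) T x))

subF-lam-view : ∀ k y R S T x → SubFLam k y R S T x (subF (suc k) (lam y R S) T x)
subF-lam-view k y R S T x with y ≟ x | x ∈? FV S
... | yes y≡x | _       = shadowed y≡x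
... | no  y≢x | no x∉S  = vacuous y≢x x∉S
... | no  y≢x | yes x∈S with y ∈? FV T
...   | no  y∉T = renamed y y≢x x∈S y∉T (λ _ v≢y → v≢y) (λ _ → refl)
...   | yes y∈T = renamed (fresh vs) y≢x x∈S (fresh-∉ vs ∘ ∈-++⁺ˡ)
                    (λ v∈S _ → ≢-sym (fresh-≢ vs (∈-++⁺ʳ (FV T) v∈S))) (λ y∉T → contradiction y∈T y∉T)
  where
  vs : List Var
  vs = FV T ++ FV S

subF-var-fuel : ∀ k v T x → subF (suc k) (var v) T x ≡ var v [ T / x ]
subF-var-fuel k v T x with v ≟ x
... | yes _ = refl
... | no  _ = refl

var-subst-hit : ∀ x T → var x [ T / x ] ≡ T
var-subst-hit x T with x ≟ x
... | yes _   = refl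
... | no  x≢x = contradiction refl x≢x

var-subst-miss : ∀ {v x} T → v ≢ x → var v [ T / x ] ≡ var v
var-subst-miss {v} {x} T v≢x with v ≟ x
... | yes v≡x = contradiction v≡x v≢x
... | no  _   = refl

size-subF-var : ∀ k S z y → size S ≤ k → size (subF k S (var z) y) ≡ size S
size-subF-var zero    S           z y _ = refl
size-subF-var (suc k) (con c)     z y _ = refl
size-subF-var (suc k) (var v)     z y _ with subF (suc k) (var v) (var z) y | subF-var-view k v (var z) y
... | _ | hit  _ = refl
... | _ | miss _ = refl
size-subF-var (suc k) (ρ R)       z y (s≤s ≤k) = cong suc (size-subF-var k R z y ≤k)
size-subF-var (suc k) (β R S)     z y (s≤s ≤k) =
  cong suc (cong₂ _+_ (size-subF-var k R z y (m+n≤o⇒m≤o (size R) ≤k))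
                      (size-subF-var k S z y (m+n≤o⇒n≤o (size R) ≤k)))
size-subF-var (suc k) (lam w R S) z y (s≤s ≤k)
  with subF (suc k) (lam w R S) (var z) y | subF-lam-view k w R S (var z) y
... | _ | shadowed _  = cong (λ n → suc (n + size S)) (size-subF-var k R z y (m+n≤o⇒m≤o (size R) ≤k))
... | _ | vacuous _ _ = cong (λ n → suc (n + size S)) (size-subF-var k R z y (m+n≤o⇒m≤o (size R) ≤k))
... | _ | renamed u _ _ _ _ _ =
  cong suc (cong₂ _+_ (size-subF-var k R z y (m+n≤o⇒m≤o (size R) ≤k))
                      (trans (size-subF-var k S′ z y (subst (_≤ k) (sym S′≡S) S≤k)) S′≡S))
  where
  S≤k : size S ≤ k
  S≤k = m+n≤o⇒n≤o (size R) ≤k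
  S′ : Term
  S′ = subF k S (var u) w
  S′≡S : size S′ ≡ size S
  S′≡S = size-subF-var k S u w S≤k

-- Nameless semantics

-- Terms with each bound variable replaced by the depth (de Bruijn level) of its binder.
data Nameless : Set where
  ncon   : Const → Nameless
  nfree  : Var → Nameless
  nlevel : ℕ → Nameless
  nρ     : Nameless → Nameless
  nβ     : Nameless → Nameless → Nameless
  nlam   : Nameless → Nameless → Nameless

-- A variable is interpreted as a function of the depth at which it occurs, since a term
-- substituted for it may contain binders.
Env : Set
Env = Var → ℕ → Nameless

_[_↦_] : {A : Set} → (ℕ → A) → ℕ → A → ℕ → A
(f [ x ↦ a ]) v with v ≟ x
... | yes _ = a
... | no  _ = f v

↦-hit : ∀ {A} (f : ℕ → A) x a → (f [ x ↦ a ]) x ≡ a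
↦-hit f x a with x ≟ x
... | yes _   = refl
... | no  x≢x = contradiction refl x≢x

↦-miss : ∀ {A} (f : ℕ → A) {x a v} → v ≢ x → (f [ x ↦ a ]) v ≡ f v
↦-miss f {x} {v = v} v≢x with v ≟ x
... | yes v≡x = contradiction v≡x v≢x
... | no  _   = refl

boundAt : ℕ → ℕ → Nameless
boundAt d _ = nlevel d

eval : Term → Env → ℕ → Nameless
eval (con c)     σ d = ncon c
eval (var v)     σ d = σ v d
eval (ρ R)       σ d = nρ (eval R σ d)
eval (β R S)     σ d = nβ (eval R σ d) (eval S σ d)
eval (lam x R S) σ d = nlam (eval R σ d) (eval S (σ [ x ↦ boundAt d ]) (suc d))

AgreeOn : List Var → Env → Env → Set
AgreeOn vs σ τ = ∀ {v} → v ∈ vs → ∀ e → σ v e ≡ τ v e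

AgreeOn-↦ : ∀ {vs σ τ} x f → (∀ {v} → v ∈ vs → v ≢ x → ∀ e → σ v e ≡ τ v e) →
            AgreeOn vs (σ [ x ↦ f ]) (τ [ x ↦ f ])
AgreeOn-↦ x f agree {v} v∈vs e with v ≟ x
... | yes _   = refl
... | no  v≢x = agree v∈vs v≢x e

eval-cong : ∀ S {σ τ} → AgreeOn (FV S) σ τ → ∀ d → eval S σ d ≡ eval S τ d
eval-cong (con c)     agree d = refl
eval-cong (var v)     agree d = agree (here refl) d
eval-cong (ρ R)       agree d = cong nρ (eval-cong R agree d)
eval-cong (β R S)     agree d =
  cong₂ nβ (eval-cong R (agree ∘ FV-β⁺ˡ R S) d) (eval-cong S (agree ∘ FV-β⁺ʳ R S) d)
eval-cong (lam x R S) agree d =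
  cong₂ nlam (eval-cong R (agree ∘ FV-lam⁺ˡ x R S) d)
             (eval-cong S (AgreeOn-↦ x (boundAt d) (λ v∈S v≢x → agree (FV-lam⁺ʳ x R S v∈S v≢x)))
                        (suc d))

AgreeOn-renamed : ∀ {x y z} S T σ d → y ≢ x → x ∈ FV S → z ∉ FV T →
                  (∀ {v} → v ∈ FV S → v ≢ y → v ≢ z) →
                  let σz = σ [ z ↦ boundAt d ]; τ = σz [ x ↦ eval T σz ] in
                  AgreeOn (FV S) (τ [ y ↦ eval (var z) τ ]) ((σ [ x ↦ eval T σ ]) [ y ↦ boundAt d ])
AgreeOn-renamed {x} {y} {z} S T σ d y≢x x∈S z∉T avoids-z {v} v∈S e with v ≟ y
... | yes _ = trans (cong-app (↦-miss (σ [ z ↦ boundAt d ]) (≢-sym (avoids-z x∈S (≢-sym y≢x)))) e)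
                    (cong-app (↦-hit σ z (boundAt d)) e)
... | no v≢y with v ≟ x
...   | yes _ = eval-cong T (λ u∈T → cong-app (↦-miss σ λ { refl → z∉T u∈T })) e
...   | no _  = cong-app (↦-miss σ (avoids-z v∈S v≢y)) e

eval-subF : ∀ k S T x σ d → size S ≤ k → eval (subF k S T x) σ d ≡ eval S (σ [ x ↦ eval T σ ]) d
eval-subF (suc k) (con c) T x σ d _ = refl
eval-subF (suc k) (var v) T x σ d _ with subF (suc k) (var v) T x | subF-var-view k v T x
... | _ | hit refl  = sym (cong-app (↦-hit σ v (eval T σ)) d)
... | _ | miss v≢x = sym (cong-app (↦-miss σ v≢x) d)
eval-subF (suc k) (ρ S) T x σ d (s≤s ≤k) = cong nρ (eval-subF k S T x σ d ≤k)
eval-subF (suc k) (β R S) T x σ d (s≤s ≤k) =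
  cong₂ nβ (eval-subF k R T x σ d (m+n≤o⇒m≤o (size R) ≤k))
           (eval-subF k S T x σ d (m+n≤o⇒n≤o (size R) ≤k))
eval-subF (suc k) (lam y R S) T x σ d (s≤s ≤k)
  with subF (suc k) (lam y R S) T x | subF-lam-view k y R S T x
... | _ | shadowed refl = cong₂ nlam (eval-subF k R T x σ d R≤k) (eval-cong S agree (suc d))
  where
  R≤k : size R ≤ k
  R≤k = m+n≤o⇒m≤o (size R) ≤k
  agree : AgreeOn (FV S) (σ [ y ↦ boundAt d ]) ((σ [ y ↦ eval T σ ]) [ y ↦ boundAt d ])
  agree {v} _ e with v ≟ y
  ... | yes _   = refl
  ... | no  v≢y = sym (cong-app (↦-miss σ v≢y) e)
... | _ | vacuous _ x∉S = cong₂ nlam (eval-subF k R T x σ d R≤k) (eval-cong S agree (suc d))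
  where
  R≤k : size R ≤ k
  R≤k = m+n≤o⇒m≤o (size R) ≤k
  agree : AgreeOn (FV S) (σ [ y ↦ boundAt d ]) ((σ [ x ↦ eval T σ ]) [ y ↦ boundAt d ])
  agree = AgreeOn-↦ y (boundAt d) λ {v} v∈S _ e →
    sym (cong-app (↦-miss σ λ { refl → x∉S v∈S }) e)
... | _ | renamed z y≢x x∈S z∉T avoids-z _ = cong₂ nlam (eval-subF k R T x σ d R≤k) (begin
    eval (subF k (subF k S (var z) y) T x) σz (suc d)
      ≡⟨ eval-subF k (subF k S (var z) y) T x σz (suc d)
           (subst (_≤ k) (sym (size-subF-var k S z y S≤k)) S≤k) ⟩
    eval (subF k S (var z) y) τ (suc d)
      ≡⟨ eval-subF k S (var z) y τ (suc d) S≤k ⟩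
    eval S (τ [ y ↦ eval (var z) τ ]) (suc d)
      ≡⟨ eval-cong S (AgreeOn-renamed S T σ d y≢x x∈S z∉T avoids-z) (suc d) ⟩
    eval S ((σ [ x ↦ eval T σ ]) [ y ↦ boundAt d ]) (suc d) ∎)
  where
  open ≡-Reasoning
  R≤k : size R ≤ k
  R≤k = m+n≤o⇒m≤o (size R) ≤k
  S≤k : size S ≤ k
  S≤k = m+n≤o⇒n≤o (size R) ≤k
  σz τ : Env
  σz = σ [ z ↦ boundAt d ]
  τ  = σz [ x ↦ eval T σz ]

eval-subst : ∀ S T x σ d → eval (S [ T / x ]) σ d ≡ eval S (σ [ x ↦ eval T σ ]) d
eval-subst S T x σ d = eval-subF (size S) S T x σ d ≤-refl

-- Coincides with ≡α (≡α⇒≅, ≅⇒≡α); this turns the substitution identities below into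
-- computations with environments.
infix 4 _≅_

record _≅_ (S S′ : Term) : Set where
  field eval-≡ : ∀ σ d → eval S σ d ≡ eval S′ σ d
open _≅_

≅-sym : ∀ {S S′} → S ≅ S′ → S′ ≅ S
eval-≡ (≅-sym S≅S′) σ d = sym (eval-≡ S≅S′ σ d)

lam-rename≅ : ∀ x y R S → y ∉ FV S → lam y R (S [ var y / x ]) ≅ lam x R S
eval-≡ (lam-rename≅ x y R S y∉S) σ d =
  cong (nlam (eval R σ d)) (trans (eval-subst S (var y) x σy (suc d)) (eval-cong S agree (suc d)))
  where
  σy : Env
  σy = σ [ y ↦ boundAt d ]
  agree : AgreeOn (FV S) (σy [ x ↦ eval (var y) σy ]) (σ [ x ↦ boundAt d ])
  agree {v} v∈S e with v ≟ x
  ... | yes _ = cong-app (↦-hit σ y (boundAt d)) e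
  ... | no  _ = cong-app (↦-miss σ λ { refl → y∉S v∈S }) e

⟶α⇒eval-≡ : ∀ {S S′} → S ⟶α S′ → ∀ σ d → eval S σ d ≡ eval S′ σ d
⟶α⇒eval-≡ (rename {x} {y} {R} {S} _ y∉S) σ d = sym (eval-≡ (lam-rename≅ x y R S (y∉S ∘ ∈-++⁺ˡ)) σ d)
⟶α⇒eval-≡ (ρ-cong r) σ d = cong nρ (⟶α⇒eval-≡ r σ d)
⟶α⇒eval-≡ (β-congˡ {S = S} r) σ d = cong (λ D → nβ D (eval S σ d)) (⟶α⇒eval-≡ r σ d)
⟶α⇒eval-≡ (β-congʳ {R = R} r) σ d = cong (nβ (eval R σ d)) (⟶α⇒eval-≡ r σ d)
⟶α⇒eval-≡ (lam-congˡ {x} {S = S} r) σ d =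
  cong (λ D → nlam D (eval S (σ [ x ↦ boundAt d ]) (suc d))) (⟶α⇒eval-≡ r σ d)
⟶α⇒eval-≡ (lam-congʳ {x} {R} r) σ d =
  cong (nlam (eval R σ d)) (⟶α⇒eval-≡ r (σ [ x ↦ boundAt d ]) (suc d))

≡α⇒≅ : ∀ {S S′} → S ≡α S′ → S ≅ S′
eval-≡ (≡α⇒≅ ε)        σ d = refl
eval-≡ (≡α⇒≅ (r ◅ rs)) σ d = trans (⟶α⇒eval-≡ r σ d) (eval-≡ (≡α⇒≅ rs) σ d)

≅-trans : ∀ {S S′ S″} → S ≅ S′ → S′ ≅ S″ → S ≅ S″
eval-≡ (≅-trans S≅S′ S′≅S″) σ d = trans (eval-≡ S≅S′ σ d) (eval-≡ S′≅S″ σ d)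

ρ-cong≅ : ∀ {S S′} → S ≅ S′ → ρ S ≅ ρ S′
eval-≡ (ρ-cong≅ S≅S′) σ d = cong nρ (eval-≡ S≅S′ σ d)

subst-cong≅ : ∀ {S S′} T x → S ≅ S′ → S [ T / x ] ≅ S′ [ T / x ]
eval-≡ (subst-cong≅ {S} {S′} T x S≅S′) σ d =
  trans (eval-subst S T x σ d) (trans (eval-≡ S≅S′ _ d) (sym (eval-subst S′ T x σ d)))

subst-∉≅ : ∀ S T x → x ∉ FV S → S [ T / x ] ≅ S
eval-≡ (subst-∉≅ S T x x∉S) σ d =
  trans (eval-subst S T x σ d) (eval-cong S (λ v∈S → cong-app (↦-miss σ λ { refl → x∉S v∈S })) d)

ρ-subst≅ : ∀ S T x → ρ S [ T / x ] ≅ ρ (S [ T / x ])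
eval-≡ (ρ-subst≅ S T x) σ d = trans (eval-subst (ρ S) T x σ d) (cong nρ (sym (eval-subst S T x σ d)))

β-subst≅ : ∀ R S T x → β R S [ T / x ] ≅ β (R [ T / x ]) (S [ T / x ])
eval-≡ (β-subst≅ R S T x) σ d =
  trans (eval-subst (β R S) T x σ d) (sym (cong₂ nβ (eval-subst R T x σ d) (eval-subst S T x σ d)))

lam-subst≅ : ∀ w Q S T x → w ≢ x → w ∉ FV T → lam w Q S [ T / x ] ≅ lam w (Q [ T / x ]) (S [ T / x ])
eval-≡ (lam-subst≅ w Q S T x w≢x w∉T) σ d =
  trans (eval-subst (lam w Q S) T x σ d)
        (sym (cong₂ nlam (eval-subst Q T x σ d)
                         (trans (eval-subst S T x σw (suc d)) (eval-cong S agree (suc d)))))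
  where
  σw : Env
  σw = σ [ w ↦ boundAt d ]
  agree : AgreeOn (FV S) (σw [ x ↦ eval T σw ]) ((σ [ x ↦ eval T σ ]) [ w ↦ boundAt d ])
  agree {v} _ e with v ≟ w | v ≟ x
  ... | yes refl | yes refl = contradiction refl w≢x
  ... | yes refl | no  _    = cong-app (↦-hit σ v (boundAt d)) e
  ... | no  v≢w  | yes refl = trans (eval-cong T (λ u∈T → cong-app (↦-miss σ λ { refl → w∉T u∈T })) e)
                                     (sym (cong-app (↦-hit σ v (eval T σ)) e))
  ... | no  v≢w  | no  v≢x  = trans (cong-app (↦-miss σ v≢w) e) (sym (cong-app (↦-miss σ v≢x) e))

subst-through≅ : ∀ R S x w → w ∉ FV R → R [ S / x ] ≅ (R [ var w / x ]) [ S / w ]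
eval-≡ (subst-through≅ R S x w w∉R) σ d = begin
  eval (R [ S / x ]) σ d                     ≡⟨ eval-subst R S x σ d ⟩
  eval R (σ [ x ↦ eval S σ ]) d              ≡⟨ eval-cong R agree d ⟨
  eval R (σS [ x ↦ eval (var w) σS ]) d      ≡⟨ eval-subst R (var w) x σS d ⟨
  eval (R [ var w / x ]) σS d                ≡⟨ eval-subst (R [ var w / x ]) S w σ d ⟨
  eval ((R [ var w / x ]) [ S / w ]) σ d     ∎
  where
  open ≡-Reasoning
  σS : Env
  σS = σ [ w ↦ eval S σ ]
  agree : AgreeOn (FV R) (σS [ x ↦ eval (var w) σS ]) (σ [ x ↦ eval S σ ])
  agree {v} v∈R e with v ≟ x
  ... | yes _ = cong-app (↦-hit σ w (eval S σ)) e
  ... | no  _ = cong-app (↦-miss σ λ { refl → w∉R v∈R }) e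

subst-subst≅ : ∀ R S w T x → w ≢ x → w ∉ FV T →
               (R [ S / w ]) [ T / x ] ≅ (R [ T / x ]) [ S [ T / x ] / w ]
eval-≡ (subst-subst≅ R S w T x w≢x w∉T) σ d = begin
  eval ((R [ S / w ]) [ T / x ]) σ d            ≡⟨ eval-subst (R [ S / w ]) T x σ d ⟩
  eval (R [ S / w ]) σx d                       ≡⟨ eval-subst R S w σx d ⟩
  eval R (σx [ w ↦ eval S σx ]) d               ≡⟨ eval-cong R agree d ⟩
  eval R (σS [ x ↦ eval T σS ]) d               ≡⟨ eval-subst R T x σS d ⟨
  eval (R [ T / x ]) σS d                       ≡⟨ eval-subst (R [ T / x ]) (S [ T / x ]) w σ d ⟨
  eval ((R [ T / x ]) [ S [ T / x ] / w ]) σ d  ∎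
  where
  open ≡-Reasoning
  σx σS : Env
  σx = σ [ x ↦ eval T σ ]
  σS = σ [ w ↦ eval (S [ T / x ]) σ ]
  agree : AgreeOn (FV R) (σx [ w ↦ eval S σx ]) (σS [ x ↦ eval T σS ])
  agree {v} _ e with v ≟ w | v ≟ x
  ... | yes refl | yes refl = contradiction refl w≢x
  ... | yes refl | no  _    = sym (trans (cong-app (↦-hit σ v (eval (S [ T / x ]) σ)) e)
                                          (eval-subst S T x σ e))
  ... | no  v≢w  | yes refl = trans (cong-app (↦-hit σ v (eval T σ)) e)
                                     (sym (eval-cong T (λ u∈T → cong-app (↦-miss σ λ { refl → w∉T u∈T })) e))
  ... | no  v≢w  | no  v≢x  = trans (cong-app (↦-miss σ v≢x) e) (sym (cong-app (↦-miss σ v≢w) e))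

lam-subst-rename≅ : ∀ x w Q S T y → w ∉ FV S → w ≢ y → w ∉ FV T →
                    lam x Q S [ T / y ] ≅ lam w (Q [ T / y ]) ((S [ var w / x ]) [ T / y ])
lam-subst-rename≅ x w Q S T y w∉S w≢y w∉T =
  ≅-trans (subst-cong≅ T y (≅-sym (lam-rename≅ x w Q S w∉S)))
          (lam-subst≅ w Q (S [ var w / x ]) T y w≢y w∉T)

π-subst-rename≅ : ∀ x w Q S T y → w ∉ FV S → w ≢ y → w ∉ FV T →
                  π x Q S [ T / y ] ≅ π w (Q [ T / y ]) ((S [ var w / x ]) [ T / y ])
π-subst-rename≅ x w Q S T y w∉S w≢y w∉T =
  ≅-trans (ρ-subst≅ (lam x Q S) T y) (ρ-cong≅ (lam-subst-rename≅ x w Q S T y w∉S w≢y w∉T))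

subst-subst-rename≅ : ∀ R S x w T y → w ∉ FV R → w ≢ y → w ∉ FV T →
                      (R [ S / x ]) [ T / y ] ≅ ((R [ var w / x ]) [ T / y ]) [ S [ T / y ] / w ]
subst-subst-rename≅ R S x w T y w∉R w≢y w∉T =
  ≅-trans (subst-cong≅ T y (subst-through≅ R S x w w∉R))
          (subst-subst≅ (R [ var w / x ]) S w T y w≢y w∉T)

FreeIn : Var → Nameless → Set
FreeIn v (ncon _)   = ⊥
FreeIn v (nfree u)  = v ≡ u
FreeIn v (nlevel _) = ⊥
FreeIn v (nρ D)     = FreeIn v D
FreeIn v (nβ D E)   = FreeIn v D ⊎ FreeIn v E
FreeIn v (nlam D E) = FreeIn v D ⊎ FreeIn v E

FreeIn-eval⁻ : ∀ {v} S σ e → FreeIn v (eval S σ e) →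
               Σ[ u ∈ Var ] u ∈ FV S × Σ[ e′ ∈ ℕ ] FreeIn v (σ u e′)
FreeIn-eval⁻ (var u) σ e v∈ = u , here refl , e , v∈
FreeIn-eval⁻ (ρ R) σ e v∈ = FreeIn-eval⁻ R σ e v∈
FreeIn-eval⁻ (β R S) σ e (inj₁ v∈) with FreeIn-eval⁻ R σ e v∈
... | u , u∈R , rest = u , FV-β⁺ˡ R S u∈R , rest
FreeIn-eval⁻ (β R S) σ e (inj₂ v∈) with FreeIn-eval⁻ S σ e v∈
... | u , u∈S , rest = u , FV-β⁺ʳ R S u∈S , rest
FreeIn-eval⁻ (lam x R S) σ e (inj₁ v∈) with FreeIn-eval⁻ R σ e v∈
... | u , u∈R , rest = u , FV-lam⁺ˡ x R S u∈R , rest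
FreeIn-eval⁻ {v} (lam x R S) σ e (inj₂ v∈) with FreeIn-eval⁻ S (σ [ x ↦ boundAt e ]) (suc e) v∈
... | u , u∈S , e′ , v∈σu with u ≟ x
...   | yes refl = ⊥-elim v∈σu
...   | no  u≢x  = u , FV-lam⁺ʳ x R S u∈S u≢x , e′ , v∈σu

FreeIn-eval⁺ : ∀ {v} S σ → (∀ e → σ v e ≡ nfree v) → v ∈ FV S → ∀ e → FreeIn v (eval S σ e)
FreeIn-eval⁺ {v} (var u) σ σv≡v (here refl) e = subst (FreeIn v) (sym (σv≡v e)) refl
FreeIn-eval⁺ (ρ R) σ σv≡v v∈ e = FreeIn-eval⁺ R σ σv≡v v∈ e
FreeIn-eval⁺ (β R S) σ σv≡v v∈ e with FV-β⁻ R S v∈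
... | inj₁ v∈R = inj₁ (FreeIn-eval⁺ R σ σv≡v v∈R e)
... | inj₂ v∈S = inj₂ (FreeIn-eval⁺ S σ σv≡v v∈S e)
FreeIn-eval⁺ (lam x R S) σ σv≡v v∈ e with FV-lam⁻ x R S v∈
... | inj₁ v∈R = inj₁ (FreeIn-eval⁺ R σ σv≡v v∈R e)
... | inj₂ (v∈S , v≢x) =
  inj₂ (FreeIn-eval⁺ S (σ [ x ↦ boundAt e ]) (λ e′ → trans (cong-app (↦-miss σ v≢x) e′) (σv≡v e′))
                     v∈S (suc e))

idEnv : Env
idEnv v _ = nfree v

FV⇒FreeIn : ∀ {v} S d → v ∈ FV S → FreeIn v (eval S idEnv d)
FV⇒FreeIn S d v∈S = FreeIn-eval⁺ S idEnv (λ _ → refl) v∈S d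

FreeIn⇒FV : ∀ {v} S d → FreeIn v (eval S idEnv d) → v ∈ FV S
FreeIn⇒FV S d v∈ with FreeIn-eval⁻ S idEnv d v∈
... | _ , u∈S , _ , refl = u∈S

FV-≅ : ∀ {v S S′} → S ≅ S′ → v ∈ FV S → v ∈ FV S′
FV-≅ {v} {S} {S′} S≅S′ v∈S =
  FreeIn⇒FV S′ 0 (subst (FreeIn v) (eval-≡ S≅S′ idEnv 0) (FV⇒FreeIn S 0 v∈S))

FV-subst⁻ : ∀ {v} S T x → v ∈ FV (S [ T / x ]) → v ∈ FV T ⊎ (v ∈ FV S × v ≢ x)
FV-subst⁻ {v} S T x v∈
  with FreeIn-eval⁻ S (idEnv [ x ↦ eval T idEnv ]) 0
         (subst (FreeIn v) (eval-subst S T x idEnv 0) (FV⇒FreeIn (S [ T / x ]) 0 v∈))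
... | u , u∈S , e , v∈σu with u ≟ x
...   | yes refl = inj₁ (FreeIn⇒FV T e v∈σu)
...   | no  u≢x  with v∈σu
...     | refl = inj₂ (u∈S , u≢x)

-- α-equivalence from equal denotations

subF-∉ : ∀ k S T x → x ∉ FV S → subF k S T x ≡ S
subF-∉ zero    S       T x _   = refl
subF-∉ (suc k) (con c) T x _   = refl
subF-∉ (suc k) (var v) T x x∉S with subF (suc k) (var v) T x | subF-var-view k v T x
... | _ | hit refl = contradiction (here refl) x∉S
... | _ | miss _   = refl
subF-∉ (suc k) (ρ R)   T x x∉S = cong ρ (subF-∉ k R T x x∉S)
subF-∉ (suc k) (β R S) T x x∉S =
  cong₂ β (subF-∉ k R T x (x∉S ∘ FV-β⁺ˡ R S)) (subF-∉ k S T x (x∉S ∘ FV-β⁺ʳ R S))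
subF-∉ (suc k) (lam y R S) T x x∉S with subF (suc k) (lam y R S) T x | subF-lam-view k y R S T x
... | _ | shadowed _         = cong (λ R′ → lam y R′ S) (subF-∉ k R T x (x∉S ∘ FV-lam⁺ˡ y R S))
... | _ | vacuous _ _        = cong (λ R′ → lam y R′ S) (subF-∉ k R T x (x∉S ∘ FV-lam⁺ˡ y R S))
... | _ | renamed _ y≢x x∈S _ _ _ = contradiction (FV-lam⁺ʳ y R S x∈S (≢-sym y≢x)) x∉S

subF-self : ∀ k S y → subF k S (var y) y ≡ S
subF-self zero    S       y = refl
subF-self (suc k) (con c) y = refl
subF-self (suc k) (var v) y with subF (suc k) (var v) (var y) y | subF-var-view k v (var y) y
... | _ | hit refl = refl
... | _ | miss _   = refl
subF-self (suc k) (ρ R)   y = cong ρ (subF-self k R y)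
subF-self (suc k) (β R S) y = cong₂ β (subF-self k R y) (subF-self k S y)
subF-self (suc k) (lam w R S) y with subF (suc k) (lam w R S) (var y) y | subF-lam-view k w R S (var y) y
... | _ | shadowed _  = cong (λ R′ → lam w R′ S) (subF-self k R y)
... | _ | vacuous _ _ = cong (λ R′ → lam w R′ S) (subF-self k R y)
... | _ | renamed z w≢y _ _ _ w∉y⇒z≡w with w∉y⇒z≡w (λ { (here w≡y) → w≢y w≡y })
...   | refl =
  cong₂ (lam w) (subF-self k R y) (trans (subF-self k (subF k S (var w) w) y) (subF-self k S w))

-- The binder at depth k is named N + k, where N exceeds every variable of the terms involved.
readBack : ℕ → ℕ → Nameless → Term
readBack N d (ncon c)   = con c
readBack N d (nfree v)  = var v
readBack N d (nlevel k) = var (N + k)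
readBack N d (nρ D)     = ρ (readBack N d D)
readBack N d (nβ D E)   = β (readBack N d D) (readBack N d E)
readBack N d (nlam D E) = lam (N + d) (readBack N d D) (readBack N (suc d) E)

mapAtoms : (Var → Nameless) → (ℕ → Nameless) → Nameless → Nameless
mapAtoms f g (ncon c)   = ncon c
mapAtoms f g (nfree v)  = f v
mapAtoms f g (nlevel k) = g k
mapAtoms f g (nρ D)     = nρ (mapAtoms f g D)
mapAtoms f g (nβ D E)   = nβ (mapAtoms f g D) (mapAtoms f g E)
mapAtoms f g (nlam D E) = nlam (mapAtoms f g D) (mapAtoms f g E)

eval-mapAtoms : ∀ S σ d f g → (∀ {k} → d ≤ k → g k ≡ nlevel k) →
                eval S (λ v e → mapAtoms f g (σ v e)) d ≡ mapAtoms f g (eval S σ d)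
eval-mapAtoms (con c)     σ d f g g-id = refl
eval-mapAtoms (var v)     σ d f g g-id = refl
eval-mapAtoms (ρ R)       σ d f g g-id = cong nρ (eval-mapAtoms R σ d f g g-id)
eval-mapAtoms (β R S)     σ d f g g-id =
  cong₂ nβ (eval-mapAtoms R σ d f g g-id) (eval-mapAtoms S σ d f g g-id)
eval-mapAtoms (lam x R S) σ d f g g-id =
  cong₂ nlam (eval-mapAtoms R σ d f g g-id)
             (trans (eval-cong S agree (suc d))
                    (eval-mapAtoms S (σ [ x ↦ boundAt d ]) (suc d) f g (g-id ∘ <⇒≤)))
  where
  agree : AgreeOn (FV S) ((λ v e → mapAtoms f g (σ v e)) [ x ↦ boundAt d ])
                         (λ v e → mapAtoms f g ((σ [ x ↦ boundAt d ]) v e))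
  agree {v} _ e with v ≟ x
  ... | yes _ = sym (g-id ≤-refl)
  ... | no  _ = refl

∉BV-readBack : ∀ {v} N e D → v < N + e → v ∉ BV (readBack N e D)
∉BV-readBack N e (nρ D) v<N+e v∈ = ∉BV-readBack N e D v<N+e v∈
∉BV-readBack N e (nβ D E) v<N+e v∈ with ∈-++⁻ (BV (readBack N e D)) v∈
... | inj₁ v∈D = ∉BV-readBack N e D v<N+e v∈D
... | inj₂ v∈E = ∉BV-readBack N e E v<N+e v∈E
∉BV-readBack N e (nlam D E) v<N+e (here refl) = <-irrefl refl v<N+e
∉BV-readBack N e (nlam D E) v<N+e (there v∈) with ∈-++⁻ (BV (readBack N e D)) v∈
... | inj₁ v∈D = ∉BV-readBack N e D v<N+e v∈D
... | inj₂ v∈E = ∉BV-readBack N (suc e) E (<-≤-trans v<N+e (+-monoʳ-≤ N (n≤1+n e))) v∈E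

LevelIn : ℕ → Nameless → Set
LevelIn k (ncon _)   = ⊥
LevelIn k (nfree _)  = ⊥
LevelIn k (nlevel j) = k ≡ j
LevelIn k (nρ D)     = LevelIn k D
LevelIn k (nβ D E)   = LevelIn k D ⊎ LevelIn k E
LevelIn k (nlam D E) = LevelIn k D ⊎ LevelIn k E

FV-readBack : ∀ {v} N e D → v ∈ FV (readBack N e D) → FreeIn v D ⊎ Σ[ j ∈ ℕ ] v ≡ N + j × LevelIn j D
FV-readBack N e (nfree u)  (here refl) = inj₁ refl
FV-readBack N e (nlevel j) (here refl) = inj₂ (j , refl , refl)
FV-readBack N e (nρ D) v∈ = FV-readBack N e D v∈
FV-readBack N e (nβ D E) v∈ with FV-β⁻ (readBack N e D) (readBack N e E) v∈
... | inj₁ v∈D = Sum.map inj₁ (λ (j , v≡ , j∈) → j , v≡ , inj₁ j∈) (FV-readBack N e D v∈D)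
... | inj₂ v∈E = Sum.map inj₂ (λ (j , v≡ , j∈) → j , v≡ , inj₂ j∈) (FV-readBack N e E v∈E)
FV-readBack N e (nlam D E) v∈ with FV-lam⁻ (N + e) (readBack N e D) (readBack N (suc e) E) v∈
... | inj₁ v∈D       = Sum.map inj₁ (λ (j , v≡ , j∈) → j , v≡ , inj₁ j∈) (FV-readBack N e D v∈D)
... | inj₂ (v∈E , _) = Sum.map inj₂ (λ (j , v≡ , j∈) → j , v≡ , inj₂ j∈) (FV-readBack N (suc e) E v∈E)

LevelIn-eval⁻ : ∀ {k} S σ e → LevelIn k (eval S σ e) →
                (Σ[ u ∈ Var ] Σ[ e′ ∈ ℕ ] LevelIn k (σ u e′)) ⊎ e ≤ k
LevelIn-eval⁻ (var u) σ e k∈ = inj₁ (u , e , k∈)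
LevelIn-eval⁻ (ρ R) σ e k∈ = LevelIn-eval⁻ R σ e k∈
LevelIn-eval⁻ (β R S) σ e (inj₁ k∈) = LevelIn-eval⁻ R σ e k∈
LevelIn-eval⁻ (β R S) σ e (inj₂ k∈) = LevelIn-eval⁻ S σ e k∈
LevelIn-eval⁻ (lam x R S) σ e (inj₁ k∈) = LevelIn-eval⁻ R σ e k∈
LevelIn-eval⁻ (lam x R S) σ e (inj₂ k∈) with LevelIn-eval⁻ S (σ [ x ↦ boundAt e ]) (suc e) k∈
... | inj₂ e<k = inj₂ (<⇒≤ e<k)
... | inj₁ (u , e′ , k∈σu) with u ≟ x
...   | yes _ = inj₂ (≤-reflexive (sym k∈σu))
...   | no  _ = inj₁ (u , e′ , k∈σu)

-- f and g describe the substitution [a/b] on free names and on levels.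
subF-readBack : ∀ k N e D a b f g → size (readBack N e D) ≤ k →
                (∀ {j} → e ≤ j → N + j ≢ b × N + j ≢ a) →
                (∀ v e′ → readBack N e′ (f v) ≡ var v [ var a / b ]) →
                (∀ j e′ → readBack N e′ (g j) ≡ var (N + j) [ var a / b ]) →
                subF k (readBack N e D) (var a) b ≡ readBack N e (mapAtoms f g D)
subF-readBack (suc k) N e (ncon c) a b f g _ _ _ _ = refl
subF-readBack (suc k) N e (nfree v) a b f g _ _ f-ok _ =
  trans (subF-var-fuel k v (var a) b) (sym (f-ok v e))
subF-readBack (suc k) N e (nlevel j) a b f g _ _ _ g-ok =
  trans (subF-var-fuel k (N + j) (var a) b) (sym (g-ok j e))
subF-readBack (suc k) N e (nρ D) a b f g (s≤s ≤k) avoid f-ok g-ok =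
  cong ρ (subF-readBack k N e D a b f g ≤k avoid f-ok g-ok)
subF-readBack (suc k) N e (nβ D E) a b f g (s≤s ≤k) avoid f-ok g-ok =
  cong₂ β (subF-readBack k N e D a b f g (m+n≤o⇒m≤o (size (readBack N e D)) ≤k) avoid f-ok g-ok)
          (subF-readBack k N e E a b f g (m+n≤o⇒n≤o (size (readBack N e D)) ≤k) avoid f-ok g-ok)
subF-readBack (suc k) N e (nlam D E) a b f g (s≤s ≤k) avoid f-ok g-ok
  with subF (suc k) (lam (N + e) D′ E′) (var a) b | subF-lam-view k (N + e) D′ E′ (var a) b
  where
  D′ E′ : Term
  D′ = readBack N e D
  E′ = readBack N (suc e) E
... | _ | shadowed Ne≡b = contradiction Ne≡b (proj₁ (avoid ≤-refl))
... | _ | vacuous _ b∉E =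
  cong₂ (lam (N + e)) IH-D (trans (sym (subF-∉ k (readBack N (suc e) E) (var a) b b∉E)) IH-E)
  where
  IH-D : subF k (readBack N e D) (var a) b ≡ readBack N e (mapAtoms f g D)
  IH-D = subF-readBack k N e D a b f g (m+n≤o⇒m≤o (size (readBack N e D)) ≤k) avoid f-ok g-ok
  IH-E : subF k (readBack N (suc e) E) (var a) b ≡ readBack N (suc e) (mapAtoms f g E)
  IH-E = subF-readBack k N (suc e) E a b f g (m+n≤o⇒n≤o (size (readBack N e D)) ≤k)
                       (avoid ∘ <⇒≤) f-ok g-ok
... | _ | renamed z _ _ _ _ Ne∉a⇒z≡Ne with Ne∉a⇒z≡Ne (λ { (here Ne≡a) → proj₂ (avoid ≤-refl) Ne≡a })
...   | refl =
  cong₂ (lam (N + e)) IH-D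
        (trans (cong (λ E′ → subF k E′ (var a) b) (subF-self k (readBack N (suc e) E) (N + e))) IH-E)
  where
  IH-D : subF k (readBack N e D) (var a) b ≡ readBack N e (mapAtoms f g D)
  IH-D = subF-readBack k N e D a b f g (m+n≤o⇒m≤o (size (readBack N e D)) ≤k) avoid f-ok g-ok
  IH-E : subF k (readBack N (suc e) E) (var a) b ≡ readBack N (suc e) (mapAtoms f g E)
  IH-E = subF-readBack k N (suc e) E a b f g (m+n≤o⇒n≤o (size (readBack N e D)) ≤k)
                       (avoid ∘ <⇒≤) f-ok g-ok

varBound : Term → ℕ
varBound (con c)     = 0
varBound (var v)     = suc v
varBound (ρ R)       = varBound R
varBound (β R S)     = varBound R ⊔ varBound S
varBound (lam x R S) = suc x ⊔ (varBound R ⊔ varBound S)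

FV<varBound : ∀ {v} S → v ∈ FV S → v < varBound S
FV<varBound (var v) (here refl) = ≤-refl
FV<varBound (ρ R) v∈ = FV<varBound R v∈
FV<varBound (β R S) v∈ with FV-β⁻ R S v∈
... | inj₁ v∈R = m<n⇒m<n⊔o (varBound S) (FV<varBound R v∈R)
... | inj₂ v∈S = m<n⇒m<o⊔n (varBound R) (FV<varBound S v∈S)
FV<varBound (lam x R S) v∈ with FV-lam⁻ x R S v∈
... | inj₁ v∈R       = m<n⇒m<o⊔n (suc x) (m<n⇒m<n⊔o (varBound S) (FV<varBound R v∈R))
... | inj₂ (v∈S , _) = m<n⇒m<o⊔n (suc x) (m<n⇒m<o⊔n (varBound R) (FV<varBound S v∈S))

N+j≢x : ∀ {N x} j → x < N → N + j ≢ x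
N+j≢x {N} j x<N refl = <-irrefl refl (<-≤-trans x<N (m≤m+n N j))

N+j≢N+d : ∀ {N j d} → d < j → N + j ≢ N + d
N+j≢N+d {N} d<j N+j≡N+d = <⇒≢ d<j (sym (+-cancelˡ-≡ N _ _ N+j≡N+d))

readBack-rename-binder : ∀ N x B d → x < N →
  readBack N (suc d) (eval B idEnv (suc d)) [ var (N + d) / x ]
    ≡ readBack N (suc d) (eval B (idEnv [ x ↦ boundAt d ]) (suc d))
readBack-rename-binder N x B d x<N = begin
  readBack N (suc d) (eval B idEnv (suc d)) [ var (N + d) / x ]
    ≡⟨ subF-readBack _ N (suc d) (eval B idEnv (suc d)) (N + d) x f nlevel ≤-refl
         (λ {j} d<j → N+j≢x j x<N , N+j≢N+d d<j) f-ok
         (λ j _ → sym (var-subst-miss (var (N + d)) (N+j≢x j x<N))) ⟩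
  readBack N (suc d) (mapAtoms f nlevel (eval B idEnv (suc d)))
    ≡⟨ cong (readBack N (suc d)) (sym (eval-mapAtoms B idEnv (suc d) f nlevel (λ _ → refl))) ⟩
  readBack N (suc d) (eval B (λ v e → mapAtoms f nlevel (idEnv v e)) (suc d))
    ≡⟨ cong (readBack N (suc d)) (eval-cong B agree (suc d)) ⟩
  readBack N (suc d) (eval B (idEnv [ x ↦ boundAt d ]) (suc d)) ∎
  where
  open ≡-Reasoning
  f : Var → Nameless
  f = nfree [ x ↦ nlevel d ]
  f-ok : ∀ v e → readBack N e (f v) ≡ var v [ var (N + d) / x ]
  f-ok v e with v ≟ x
  ... | yes _ = refl
  ... | no  _ = refl
  agree : AgreeOn (FV B) (λ v e → mapAtoms f nlevel (idEnv v e)) (idEnv [ x ↦ boundAt d ])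
  agree {v} _ e with v ≟ x
  ... | yes _ = refl
  ... | no  _ = refl

readBack-restore-binder : ∀ N x B d → x < N → (∀ {v} → v ∈ FV B → v < N) →
  readBack N (suc d) (eval B (idEnv [ x ↦ boundAt d ]) (suc d)) [ var x / N + d ]
    ≡ readBack N (suc d) (eval B idEnv (suc d))
readBack-restore-binder N x B d x<N FV<N = begin
  readBack N (suc d) (eval B (idEnv [ x ↦ boundAt d ]) (suc d)) [ var x / N + d ]
    ≡⟨ subF-readBack _ N (suc d) (eval B (idEnv [ x ↦ boundAt d ]) (suc d)) x (N + d) f g ≤-refl
         (λ {j} d<j → N+j≢N+d d<j , N+j≢x j x<N) f-ok g-ok ⟩
  readBack N (suc d) (mapAtoms f g (eval B (idEnv [ x ↦ boundAt d ]) (suc d)))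
    ≡⟨ cong (readBack N (suc d)) (sym (eval-mapAtoms B (idEnv [ x ↦ boundAt d ]) (suc d) f g
         (λ d<k → ↦-miss nlevel (<⇒≢ d<k ∘ sym)))) ⟩
  readBack N (suc d) (eval B (λ v e → mapAtoms f g ((idEnv [ x ↦ boundAt d ]) v e)) (suc d))
    ≡⟨ cong (readBack N (suc d)) (eval-cong B agree (suc d)) ⟩
  readBack N (suc d) (eval B idEnv (suc d)) ∎
  where
  open ≡-Reasoning
  f : Var → Nameless
  f = nfree [ N + d ↦ nfree x ]
  g : ℕ → Nameless
  g = nlevel [ d ↦ nfree x ]
  f-ok : ∀ v e → readBack N e (f v) ≡ var v [ var x / N + d ]
  f-ok v e with v ≟ N + d
  ... | yes _ = refl
  ... | no  _ = refl
  g-ok : ∀ j e → readBack N e (g j) ≡ var (N + j) [ var x / N + d ]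
  g-ok j e with j ≟ d
  ... | yes refl = sym (var-subst-hit (N + j) (var x))
  ... | no  j≢d  = sym (var-subst-miss (var x) (j≢d ∘ +-cancelˡ-≡ N _ _))
  agree : AgreeOn (FV B) (λ v e → mapAtoms f g ((idEnv [ x ↦ boundAt d ]) v e)) idEnv
  agree {v} v∈B e with v ≟ x
  ... | yes refl = ↦-hit nlevel d (nfree x)
  ... | no  _    = ↦-miss nfree (<⇒≢ (<-≤-trans (FV<N v∈B) (m≤m+n N d)))

∉AllV : ∀ {v} S → v ∉ FV S → v ∉ BV S → v ∉ AllV S
∉AllV S v∉FV v∉BV v∈ = [ v∉FV , v∉BV ]′ (∈-++⁻ (FV S) v∈)

≡α-readBack : ∀ N S d → varBound S ≤ N → S ≡α readBack N d (eval S idEnv d)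
≡α-readBack N (con c) d _ = ε
≡α-readBack N (var v) d _ = ε
≡α-readBack N (ρ R) d ≤N = gmap ρ ρ-cong (≡α-readBack N R d ≤N)
≡α-readBack N (β R S) d ≤N =
  gmap (λ R′ → β R′ S) β-congˡ (≡α-readBack N R d (m⊔n≤o⇒m≤o _ _ ≤N)) ◅◅
  gmap (β _) β-congʳ (≡α-readBack N S d (m⊔n≤o⇒n≤o _ _ ≤N))
≡α-readBack N (lam x R B) d ≤N =
  gmap (λ R′ → lam x R′ B) lam-congˡ (≡α-readBack N R d (m⊔n≤o⇒m≤o (varBound R) _ RB≤N)) ◅◅
  gmap (lam x R*) lam-congʳ (≡α-readBack N B (suc d) B≤N) ◅◅
  subst (λ B′ → lam x R* B* ⟶α lam (N + d) R* B′) (readBack-rename-binder N x B d x<N)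
        (rename (∉BV-readBack N (suc d) E* (<-≤-trans x<N (m≤m+n N (suc d))))
                (∉AllV B* N+d∉FV (∉BV-readBack N (suc d) E* (+-monoʳ-< N (n<1+n d))))) ◅ ε
  where
  x<N : x < N
  x<N = m⊔n≤o⇒m≤o (suc x) (varBound R ⊔ varBound B) ≤N
  RB≤N : varBound R ⊔ varBound B ≤ N
  RB≤N = m⊔n≤o⇒n≤o (suc x) (varBound R ⊔ varBound B) ≤N
  B≤N : varBound B ≤ N
  B≤N = m⊔n≤o⇒n≤o (varBound R) _ RB≤N
  E* : Nameless
  E* = eval B idEnv (suc d)
  R* B* : Term
  R* = readBack N d (eval R idEnv d)
  B* = readBack N (suc d) E*
  N+d∉FV : N + d ∉ FV B*
  N+d∉FV N+d∈ with FV-readBack N (suc d) E* N+d∈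
  ... | inj₁ free = N+j≢x d (<-≤-trans (FV<varBound B (FreeIn⇒FV B (suc d) free)) B≤N) refl
  ... | inj₂ (j , N+d≡N+j , j∈) with LevelIn-eval⁻ B idEnv (suc d) j∈
  ...   | inj₂ d<j = N+j≢N+d d<j (sym N+d≡N+j)

readBack-≡α : ∀ N S d → varBound S ≤ N → readBack N d (eval S idEnv d) ≡α S
readBack-≡α N (con c) d _ = ε
readBack-≡α N (var v) d _ = ε
readBack-≡α N (ρ R) d ≤N = gmap ρ ρ-cong (readBack-≡α N R d ≤N)
readBack-≡α N (β R S) d ≤N =
  gmap (λ R′ → β R′ _) β-congˡ (readBack-≡α N R d (m⊔n≤o⇒m≤o _ _ ≤N)) ◅◅
  gmap (β R) β-congʳ (readBack-≡α N S d (m⊔n≤o⇒n≤o _ _ ≤N))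
readBack-≡α N (lam x R B) d ≤N =
  gmap (λ R′ → lam (N + d) R′ B°) lam-congˡ (readBack-≡α N R d (m⊔n≤o⇒m≤o (varBound R) _ RB≤N)) ◅◅
  subst (λ B′ → lam (N + d) R B° ⟶α lam x R B′) (readBack-restore-binder N x B d x<N FV<N)
        (rename (∉BV-readBack N (suc d) E° (+-monoʳ-< N (n<1+n d)))
                (∉AllV B° x∉FV (∉BV-readBack N (suc d) E° (<-≤-trans x<N (m≤m+n N (suc d)))))) ◅
  gmap (lam x R) lam-congʳ (readBack-≡α N B (suc d) B≤N)
  where
  x<N : x < N
  x<N = m⊔n≤o⇒m≤o (suc x) (varBound R ⊔ varBound B) ≤N
  RB≤N : varBound R ⊔ varBound B ≤ N
  RB≤N = m⊔n≤o⇒n≤o (suc x) (varBound R ⊔ varBound B) ≤N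
  B≤N : varBound B ≤ N
  B≤N = m⊔n≤o⇒n≤o (varBound R) _ RB≤N
  FV<N : ∀ {v} → v ∈ FV B → v < N
  FV<N v∈B = <-≤-trans (FV<varBound B v∈B) B≤N
  E° : Nameless
  E° = eval B (idEnv [ x ↦ boundAt d ]) (suc d)
  B° : Term
  B° = readBack N (suc d) E°
  x∉FV : x ∉ FV B°
  x∉FV x∈ with FV-readBack N (suc d) E° x∈
  ... | inj₂ (j , x≡N+j , _) = N+j≢x j x<N (sym x≡N+j)
  ... | inj₁ free with FreeIn-eval⁻ B (idEnv [ x ↦ boundAt d ]) (suc d) free
  ...   | u , _ , _ , x∈σu with u ≟ x
  ...     | no u≢x = u≢x (sym x∈σu)

-- Both terms are α-converted into the read-back of their common denotation.
≅⇒≡α : ∀ {S S′} → S ≅ S′ → S ≡α S′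
≅⇒≡α {S} {S′} S≅S′ =
  ≡α-readBack N S 0 (m≤m⊔n _ _) ◅◅
  subst (λ D → readBack N 0 D ≡α S′) (sym (eval-≡ S≅S′ idEnv 0)) (readBack-≡α N S′ 0 (m≤n⊔m _ _))
  where N = varBound S ⊔ varBound S′

-- Weakening and compactness of derivations

≈ₛ-refl : ∀ {X} → X ≈ₛ X
≈ₛ-refl = ε , ε

≈ₛ-trans : ∀ {X Y Z} → X ≈ₛ Y → Y ≈ₛ Z → X ≈ₛ Z
≈ₛ-trans (S≡ , P≡) (S≡′ , P≡′) = S≡ ◅◅ S≡′ , P≡ ◅◅ P≡′

≅⇒≈ₛ : ∀ {S S′ P P′} → S ≅ S′ → P ≅ P′ → (S , P) ≈ₛ (S′ , P′)
≅⇒≈ₛ S≅S′ P≅P′ = ≅⇒≡α S≅S′ , ≅⇒≡α P≅P′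

⊆⇒⊆ₛ : ∀ {Γ Δ} → (∀ {Y} → Δ Y → Γ Y) → Δ ⊆ₛ Γ
⊆⇒⊆ₛ Δ⊆Γ _ (Y , Y∈Δ , Y≈X) = Y , Δ⊆Γ Y∈Δ , Y≈X

⊆ₛ-trans : ∀ {Γ Δ Θ} → Θ ⊆ₛ Δ → Δ ⊆ₛ Γ → Θ ⊆ₛ Γ
⊆ₛ-trans Θ⊆Δ Δ⊆Γ X X∈Θ = Δ⊆Γ X (Θ⊆Δ X X∈Θ)

⟦⟧-⊆ₛ : ∀ {Γ X} → Γ X → ⟦ X ⟧ ⊆ₛ Γ
⟦⟧-⊆ₛ X∈Γ = ⊆⇒⊆ₛ λ { refl → X∈Γ }

⊢-mono : ∀ n {Γ Δ X} → Δ ⊆ₛ Γ → Δ ⊢[ n ] X → Γ ⊢[ n ] X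
⊢-mono zero    Δ⊆Γ (lift X∈Δ) = lift (Δ⊆Γ _ X∈Δ)
⊢-mono (suc n) Δ⊆Γ D          = mono Δ⊆Γ D

⊢-conv : ∀ n {Γ X Y} → X ≈ₛ Y → Γ ⊢[ n ] X → Γ ⊢[ n ] Y
⊢-conv zero    X≈Y (lift (Z , Z∈Γ , Z≈X)) = lift (Z , Z∈Γ , ≈ₛ-trans Z≈X X≈Y)
⊢-conv (suc n) X≈Y D                      = conv X≈Y D

⊢-member : ∀ n {Γ X} → X ∈ₛ Γ → Γ ⊢[ n ] X
⊢-member zero    X∈Γ               = lift X∈Γ
⊢-member (suc n) (Y , Y∈Γ , Y≈X) = conv Y≈X (mono (⟦⟧-⊆ₛ Y∈Γ) refl')

⊢-suc : ∀ n {Γ X} → Γ ⊢[ n ] X → Γ ⊢[ suc n ] X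
⊢-suc zero    (lift X∈Γ)          = ⊢-member 1 X∈Γ
⊢-suc (suc n) (mono Δ⊆Γ D)        = mono Δ⊆Γ (⊢-suc (suc n) D)
⊢-suc (suc n) refl'               = refl'
⊢-suc (suc n) (conv X≈Y D)        = conv X≈Y (⊢-suc (suc n) D)
⊢-suc (suc n) (app D E)           = app (⊢-suc n D) (⊢-suc n E)
⊢-suc (suc n) (abs y∉Γ y∉Q D)     = abs y∉Γ y∉Q (⊢-suc n D)

⊢-≤ : ∀ {m k Γ X} → m ≤ k → Γ ⊢[ m ] X → Γ ⊢[ k ] X
⊢-≤ m≤k = go (≤⇒≤′ m≤k)
  where
  go : ∀ {m k Γ X} → m ≤′ k → Γ ⊢[ m ] X → Γ ⊢[ k ] X
  go ≤′-refl       D = D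
  go (≤′-step m≤k) D = ⊢-suc _ (go m≤k D)

ctxOf : List Stmt → Ctx
ctxOf L Y = Y ∈ L

ctxOf-⊆ₛ : ∀ {Γ L} → All Γ L → ctxOf L ⊆ₛ Γ
ctxOf-⊆ₛ L⊆Γ = ⊆⇒⊆ₛ (All.lookup L⊆Γ)

[]-⊆ₛ : ∀ {Γ} → ctxOf [] ⊆ₛ Γ
[]-⊆ₛ _ (_ , () , _)

∷-⊆ₛ : ∀ {Γ Y L} → Y ∈ₛ Γ → ctxOf L ⊆ₛ Γ → ctxOf (Y ∷ L) ⊆ₛ Γ
∷-⊆ₛ (Z , Z∈Γ , Z≈Y) _    X (_ , here refl , Y≈X) = Z , Z∈Γ , ≈ₛ-trans Z≈Y Y≈X
∷-⊆ₛ _                L⊆Γ X (Z , there Z∈L , Z≈X) = L⊆Γ X (Z , Z∈L , Z≈X)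

⊆ₛ-ctxOf : ∀ {Γ Δ} L → All Δ L → Δ ⊆ₛ Γ → Σ[ L′ ∈ List Stmt ] All Γ L′ × ctxOf L ⊆ₛ ctxOf L′
⊆ₛ-ctxOf []      []            Δ⊆Γ = [] , [] , []-⊆ₛ
⊆ₛ-ctxOf (Y ∷ L) (Y∈Δ ∷ L⊆Δ) Δ⊆Γ with Δ⊆Γ Y (Y , Y∈Δ , ≈ₛ-refl) | ⊆ₛ-ctxOf L L⊆Δ Δ⊆Γ
... | Y′ , Y′∈Γ , Y′≈Y | L′ , L′⊆Γ , L⊆L′ =
  Y′ ∷ L′ , Y′∈Γ ∷ L′⊆Γ , ∷-⊆ₛ (Y′ , here refl , Y′≈Y) (⊆ₛ-trans L⊆L′ (⊆⇒⊆ₛ there))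

split-,, : ∀ {Γ X} L → All (Γ ,, X) L → Σ[ L′ ∈ List Stmt ] All Γ L′ × ctxOf L ⊆ₛ (ctxOf L′ ,, X)
split-,, []      []                = [] , [] , []-⊆ₛ
split-,, (Y ∷ L) (Y∈Γ,,X ∷ L⊆Γ,,X) with split-,, L L⊆Γ,,X | Y∈Γ,,X
... | L′ , L′⊆Γ , L⊆L′,,X | inj₁ Y∈Γ =
  Y ∷ L′ , Y∈Γ ∷ L′⊆Γ ,
  ∷-⊆ₛ (Y , inj₁ (here refl) , ≈ₛ-refl) (⊆ₛ-trans L⊆L′,,X (⊆⇒⊆ₛ (Sum.map₁ there)))
... | L′ , L′⊆Γ , L⊆L′,,X | inj₂ Y≡X =
  L′ , L′⊆Γ , ∷-⊆ₛ (Y , inj₂ Y≡X , ≈ₛ-refl) L⊆L′,,X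

⊢-compact : ∀ n {Γ X} → Γ ⊢[ n ] X → Σ[ L ∈ List Stmt ] All Γ L × ctxOf L ⊢[ n ] X
⊢-compact zero (lift (Y , Y∈Γ , Y≈X)) = Y ∷ [] , Y∈Γ ∷ [] , lift (Y , here refl , Y≈X)
⊢-compact (suc n) (mono Δ⊆Γ D) with ⊢-compact (suc n) D
... | L , L⊆Δ , DL with ⊆ₛ-ctxOf L L⊆Δ Δ⊆Γ
...   | L′ , L′⊆Γ , L⊆L′ = L′ , L′⊆Γ , mono L⊆L′ DL
⊢-compact (suc n) (refl' {X}) = X ∷ [] , refl ∷ [] , mono (⟦⟧-⊆ₛ (here refl)) refl'
⊢-compact (suc n) (conv X≈Y D) with ⊢-compact (suc n) D
... | L , L⊆Γ , DL = L , L⊆Γ , conv X≈Y DL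
⊢-compact (suc n) (app D E) with ⊢-compact n D | ⊢-compact n E
... | L , L⊆Γ , DL | L′ , L′⊆Γ , EL′ =
  L ++ L′ , All.++⁺ L⊆Γ L′⊆Γ ,
  app (⊢-mono n (⊆⇒⊆ₛ ∈-++⁺ˡ) DL) (⊢-mono n (⊆⇒⊆ₛ (∈-++⁺ʳ L)) EL′)
⊢-compact (suc n) (abs y∉Γ y∉Q D) with ⊢-compact n D
... | L , L⊆Γ,,X , DL with split-,, L L⊆Γ,,X
...   | L′ , L′⊆Γ , L⊆L′,,X =
  L′ , L′⊆Γ , abs (λ S P SP∈L′ → y∉Γ S P (All.lookup L′⊆Γ SP∈L′)) y∉Q (⊢-mono n L⊆L′,,X DL)

-- Renaming a variable in a derivation

FV< : ℕ → Term → Set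
FV< B S = ∀ {v} → v ∈ FV S → v < B

-- Contexts may be infinite; a bound on their free variables guarantees fresh variables.
FVBelow : ℕ → Ctx → Set
FVBelow B Γ = ∀ S P → Γ (S , P) → FV< B S × FV< B P

FV<⇒∉ : ∀ {w} S → FV< w S → w ∉ FV S
FV<⇒∉ S FV<w w∈S = <-irrefl refl (FV<w w∈S)

FVBelow⇒∉FΓ : ∀ {w Γ} → FVBelow w Γ → w ∉FΓ Γ
FVBelow⇒∉FΓ bd S P SP∈Γ = FV<⇒∉ S (proj₁ (bd S P SP∈Γ)) , FV<⇒∉ P (proj₂ (bd S P SP∈Γ))

FVBelow-mono : ∀ {B B′ Γ} → B ≤ B′ → FVBelow B Γ → FVBelow B′ Γ
FVBelow-mono B≤B′ bd S P SP∈Γ =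
  (λ v∈S → <-≤-trans (proj₁ (bd S P SP∈Γ) v∈S) B≤B′) ,
  (λ v∈P → <-≤-trans (proj₂ (bd S P SP∈Γ) v∈P) B≤B′)

FVBelow-⊆ₛ : ∀ {B Γ Δ} → Δ ⊆ₛ Γ → FVBelow B Γ → FVBelow B Δ
FVBelow-⊆ₛ Δ⊆Γ bd S P SP∈Δ with Δ⊆Γ (S , P) ((S , P) , SP∈Δ , ≈ₛ-refl)
... | (S′ , P′) , SP′∈Γ , (S′≡S , P′≡P) =
  (λ v∈S → proj₁ (bd S′ P′ SP′∈Γ) (FV-≅ (≅-sym (≡α⇒≅ S′≡S)) v∈S)) ,
  (λ v∈P → proj₂ (bd S′ P′ SP′∈Γ) (FV-≅ (≅-sym (≡α⇒≅ P′≡P)) v∈P))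

FVBelow-,, : ∀ {B Γ S P} → FVBelow B Γ → FV< B S → FV< B P → FVBelow B (Γ ,, (S , P))
FVBelow-,, bd _    _    S P (inj₁ SP∈Γ) = bd S P SP∈Γ
FVBelow-,, bd S<B P<B S P (inj₂ refl)  = S<B , P<B

FVs : List Stmt → List Var
FVs []              = []
FVs ((S , P) ∷ L) = (FV S ++ FV P) ++ FVs L

FVBelow-ctxOf : ∀ {B} L → (∀ {v} → v ∈ FVs L → v < B) → FVBelow B (ctxOf L)
FVBelow-ctxOf ((S , P) ∷ L) FVs<B S P (here refl) =
  (λ v∈S → FVs<B (∈-++⁺ˡ (∈-++⁺ˡ v∈S))) , (λ v∈P → FVs<B (∈-++⁺ˡ (∈-++⁺ʳ (FV S) v∈P)))
FVBelow-ctxOf ((S′ , P′) ∷ L) FVs<B S P (there SP∈L) =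
  FVBelow-ctxOf L (FVs<B ∘ ∈-++⁺ʳ (FV S′ ++ FV P′)) S P SP∈L

FV<-subst-var : ∀ {B z} S y → FV< B S → z < B → FV< B (S [ var z / y ])
FV<-subst-var {z = z} S y S<B z<B v∈ with FV-subst⁻ S (var z) y v∈
... | inj₁ (here refl) = z<B
... | inj₂ (v∈S , _)   = S<B v∈S

renameStmt : Var → Var → Stmt → Stmt
renameStmt y z (S , P) = S [ var z / y ] , P [ var z / y ]

renameCtx : Var → Var → Ctx → Ctx
renameCtx y z Γ Y = Σ[ X ∈ Stmt ] Γ X × Y ≡ renameStmt y z X

renameStmt-≈ₛ : ∀ y z {X Y} → X ≈ₛ Y → renameStmt y z X ≈ₛ renameStmt y z Y
renameStmt-≈ₛ y z (S≡S′ , P≡P′) =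
  ≅⇒≈ₛ (subst-cong≅ (var z) y (≡α⇒≅ S≡S′)) (subst-cong≅ (var z) y (≡α⇒≅ P≡P′))

renameCtx-⊆ₛ : ∀ {Γ Δ} y z → Δ ⊆ₛ Γ → renameCtx y z Δ ⊆ₛ renameCtx y z Γ
renameCtx-⊆ₛ y z Δ⊆Γ _ (_ , (X , X∈Δ , refl) , X′≈Y) with Δ⊆Γ X (X , X∈Δ , ≈ₛ-refl)
... | Z , Z∈Γ , Z≈X = renameStmt y z Z , (Z , Z∈Γ , refl) , ≈ₛ-trans (renameStmt-≈ₛ y z Z≈X) X′≈Y

FVBelow-renameCtx : ∀ {B Γ z} y → FVBelow B Γ → z < B → FVBelow B (renameCtx y z Γ)
FVBelow-renameCtx y bd z<B _ _ ((S , P) , SP∈Γ , refl) =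
  FV<-subst-var S y (proj₁ (bd S P SP∈Γ)) z<B , FV<-subst-var P y (proj₂ (bd S P SP∈Γ)) z<B

renameCtx-fresh : ∀ {Γ Q y} w → y ∉FΓ Γ → y ∉ FV Q →
                  renameCtx y w (Γ ,, (var y , Q)) ⊆ₛ (Γ ,, (var w , Q))
renameCtx-fresh {y = y} w y∉Γ y∉Q _ (_ , ((S , P) , inj₁ SP∈Γ , refl) , X≈Y) =
  (S , P) , inj₁ SP∈Γ ,
  ≈ₛ-trans (≅⇒≈ₛ (≅-sym (subst-∉≅ S (var w) y (proj₁ (y∉Γ S P SP∈Γ))))
                 (≅-sym (subst-∉≅ P (var w) y (proj₂ (y∉Γ S P SP∈Γ))))) X≈Y
renameCtx-fresh {Q = Q} {y} w y∉Γ y∉Q _ (_ , (_ , inj₂ refl , refl) , X≈Y) =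
  (var w , Q) , inj₂ refl ,
  ≈ₛ-trans (subst (var w ≡α_) (sym (var-subst-hit y (var w))) ε ,
            ≅⇒≡α (≅-sym (subst-∉≅ Q (var w) y y∉Q))) X≈Y

renameCtx-,, : ∀ {Γ Q y} z w → w ≢ y →
               renameCtx y z (Γ ,, (var w , Q)) ⊆ₛ (renameCtx y z Γ ,, (var w , Q [ var z / y ]))
renameCtx-,, z w w≢y _ (_ , (X , inj₁ X∈Γ , refl) , X≈Y) = renameStmt _ z X , inj₁ (X , X∈Γ , refl) , X≈Y
renameCtx-,, {Q = Q} {y} z w w≢y _ (_ , (_ , inj₂ refl , refl) , X≈Y) =
  (var w , Q [ var z / y ]) , inj₂ refl ,
  subst (λ W → (W , Q [ var z / y ]) ≈ₛ _) (var-subst-miss (var z) w≢y) X≈Y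

⊢-rename : ∀ n {B Γ X} y z → FVBelow B Γ → Γ ⊢[ n ] X → renameCtx y z Γ ⊢[ n ] renameStmt y z X
⊢-rename zero    y z _  (lift (Y , Y∈Γ , Y≈X)) =
  lift (renameStmt y z Y , (Y , Y∈Γ , refl) , renameStmt-≈ₛ y z Y≈X)
⊢-rename (suc n) y z bd (mono Δ⊆Γ D) =
  mono (renameCtx-⊆ₛ y z Δ⊆Γ) (⊢-rename (suc n) y z (FVBelow-⊆ₛ Δ⊆Γ bd) D)
⊢-rename (suc n) y z bd (refl' {X}) = mono (⟦⟧-⊆ₛ (X , refl , refl)) refl'
⊢-rename (suc n) y z bd (conv X≈Y D) = conv (renameStmt-≈ₛ y z X≈Y) (⊢-rename (suc n) y z bd D)
⊢-rename (suc n) y z bd (app {F = F} {P} {R} {S} {x} D E) =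
  conv (≅⇒≈ₛ (≅-sym (β-subst≅ F S (var z) y))
             (≅-sym (subst-subst-rename≅ R S x w (var z) y w∉R w≢y w≢z)))
       (app (⊢-conv n (ε , ≅⇒≡α (π-subst-rename≅ x w P R (var z) y w∉R w≢y w≢z)) (⊢-rename n y z bd D))
            (⊢-rename n y z bd E))
  where
  vs : List Var
  vs = y ∷ z ∷ FV R
  w : Var
  w = fresh vs
  w∉R : w ∉ FV R
  w∉R = fresh-∉ vs ∘ there ∘ there
  w≢y : w ≢ y
  w≢y = fresh-≢ vs (here refl)
  w≢z : w ∉ FV (var z)
  w≢z (here w≡z) = fresh-≢ vs (there (here refl)) w≡z
-- The binder y′ is first renamed to w, fresh for everything in sight, so that y ↦ z cannot capture.
⊢-rename (suc n) {B} {Γ} y z bd (abs {Q = Q} {S} {P} {y′} y′∉Γ y′∉Q D) =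
  conv (≅⇒≈ₛ (≅-sym (lam-subst-rename≅ y′ w Q S (var z) y w∉S w≢y w≢z))
             (≅-sym (π-subst-rename≅ y′ w Q P (var z) y w∉P w≢y w≢z)))
       (abs (FVBelow⇒∉FΓ (FVBelow-renameCtx y (FVBelow-mono (<⇒≤ B<w) bd) z<w))
            (FV<⇒∉ (Q [ var z / y ]) (FV<-subst-var Q y Q<w z<w)) E₂)
  where
  vs : List Var
  vs = B ∷ y ∷ z ∷ y′ ∷ FV Q ++ FV S ++ FV P
  w : Var
  w = fresh vs
  B<w : B < w
  B<w = ∈⇒<fresh vs (here refl)
  z<w : z < w
  z<w = ∈⇒<fresh vs (there (there (here refl)))
  w≢y : w ≢ y
  w≢y = fresh-≢ vs (there (here refl))
  w≢z : w ∉ FV (var z)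
  w≢z = FV<⇒∉ (var z) λ { (here refl) → z<w }
  y′<w : FV< w (var y′)
  y′<w (here refl) = ∈⇒<fresh vs (there (there (there (here refl))))
  Q<w : FV< w Q
  Q<w = ∈⇒<fresh vs ∘ there ∘ there ∘ there ∘ there ∘ ∈-++⁺ˡ
  w∉S : w ∉ FV S
  w∉S = fresh-∉ vs ∘ there ∘ there ∘ there ∘ there ∘ ∈-++⁺ʳ (FV Q) ∘ ∈-++⁺ˡ
  w∉P : w ∉ FV P
  w∉P = fresh-∉ vs ∘ there ∘ there ∘ there ∘ there ∘ ∈-++⁺ʳ (FV Q) ∘ ∈-++⁺ʳ (FV S)
  E₁ : (Γ ,, (var w , Q)) ⊢[ n ] (S [ var w / y′ ] , P [ var w / y′ ])
  E₁ = ⊢-mono n (renameCtx-fresh w y′∉Γ y′∉Q)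
         (⊢-rename n y′ w (FVBelow-,, (FVBelow-mono (<⇒≤ B<w) bd) y′<w Q<w) D)
  E₂ : (renameCtx y z Γ ,, (var w , Q [ var z / y ])) ⊢[ n ]
         ((S [ var w / y′ ]) [ var z / y ] , (P [ var w / y′ ]) [ var z / y ])
  E₂ = ⊢-mono n (renameCtx-,, z w w≢y)
         (⊢-rename n y z (FVBelow-,, (FVBelow-mono (m<n⇒m≤1+n B<w) bd) (λ { (here refl) → n<1+n w })
                                     (m<n⇒m<1+n ∘ Q<w)) E₁)

-- Cut

_⊢[_]*_ : Ctx → ℕ → Ctx → Set₁
Γ ⊢[ m ]* Δ = ∀ X → X ∈ₛ Δ → Γ ⊢[ m ] X

⊢*-,, : ∀ m {Γ Δ Y} → Γ ⊢[ m ]* Δ → (Γ ,, Y) ⊢[ m ]* (Δ ,, Y)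
⊢*-,, m Γ⊢Δ X (Z , inj₁ Z∈Δ , Z≈X) = ⊢-mono m (⊆⇒⊆ₛ inj₁) (Γ⊢Δ X (Z , Z∈Δ , Z≈X))
⊢*-,, m Γ⊢Δ X (Z , inj₂ refl , Z≈X) = ⊢-member m (Z , inj₂ refl , Z≈X)

⊢*-compact : ∀ m {Γ} L → Γ ⊢[ m ]* ctxOf L → Σ[ L′ ∈ List Stmt ] All Γ L′ × ctxOf L′ ⊢[ m ]* ctxOf L
⊢*-compact m [] _ = [] , [] , λ { _ (_ , () , _) }
⊢*-compact m (Y ∷ L) Γ⊢YL
  with ⊢-compact m (Γ⊢YL Y (Y , here refl , ≈ₛ-refl)) | ⊢*-compact m L (λ X → Γ⊢YL X ∘ ⊆⇒⊆ₛ there X)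
... | LY , LY⊆Γ , LY⊢Y | L′ , L′⊆Γ , L′⊢L =
  LY ++ L′ , All.++⁺ LY⊆Γ L′⊆Γ , λ
    { X (_ , here refl , Y≈X)   → ⊢-conv m Y≈X (⊢-mono m (⊆⇒⊆ₛ ∈-++⁺ˡ) LY⊢Y)
    ; X (Z , there Z∈L , Z≈X) → ⊢-mono m (⊆⇒⊆ₛ (∈-++⁺ʳ LY)) (L′⊢L X (Z , Z∈L , Z≈X)) }

cut-abs : ∀ m n {Γ Δ Q S P y} → Γ ⊢[ m ]* Δ → y ∉FΓ Δ → y ∉ FV Q →
          (Δ ,, (var y , Q)) ⊢[ n ] (S , P) → Γ ⊢[ suc n + m ] (lam y Q S , π y Q P)

-- Levels are added as n + m, so that a rule instance at level suc n + m is a Step over n + m.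
cut : ∀ m n {Γ Δ X} → Γ ⊢[ m ]* Δ → Δ ⊢[ n ] X → Γ ⊢[ n + m ] X
cut m zero    Γ⊢Δ (lift X∈Δ)       = Γ⊢Δ _ X∈Δ
cut m (suc n) Γ⊢Δ (mono Δ′⊆Δ D)    = cut m (suc n) (λ X → Γ⊢Δ X ∘ Δ′⊆Δ X) D
cut m (suc n) Γ⊢Δ refl'            = ⊢-≤ (m≤n+m m (suc n)) (Γ⊢Δ _ (_ , refl , ≈ₛ-refl))
cut m (suc n) Γ⊢Δ (conv X≈Y D)     = conv X≈Y (cut m (suc n) Γ⊢Δ D)
cut m (suc n) Γ⊢Δ (app D E)        = app (cut m n Γ⊢Δ D) (cut m n Γ⊢Δ E)
cut m (suc n) Γ⊢Δ (abs y∉Δ y∉Q D)  = cut-abs m n Γ⊢Δ y∉Δ y∉Q D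

cut-abs m n {Q = Q} {S} {P} {y} Γ⊢Δ y∉Δ y∉Q D with ⊢-compact n D
... | L , L⊆Δ,,y , L⊢SP with split-,, L L⊆Δ,,y
...   | Lδ , Lδ⊆Δ , L⊆Lδ,,y with ⊢*-compact m Lδ (λ X → Γ⊢Δ X ∘ ctxOf-⊆ₛ Lδ⊆Δ X)
...     | LΓ , LΓ⊆Γ , LΓ⊢Lδ =
  mono (ctxOf-⊆ₛ LΓ⊆Γ)
       (conv (≅⇒≈ₛ (lam-rename≅ y w Q S w∉S) (ρ-cong≅ (lam-rename≅ y w Q P w∉P)))
             (abs (λ S′ P′ → fresh-for S′ P′ ∘ there) (fresh-∉ vs ∘ ∈-++⁺ˡ)
                  (cut m n (⊢*-,, m LΓ⊢Lδ) premise-renamed)))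
  where
  vs : List Var
  vs = FV Q ++ FVs ((S , P) ∷ LΓ)
  w : Var
  w = fresh vs
  fresh-for : w ∉FΓ ctxOf ((S , P) ∷ LΓ)
  fresh-for = FVBelow⇒∉FΓ (FVBelow-ctxOf ((S , P) ∷ LΓ) (∈⇒<fresh vs ∘ ∈-++⁺ʳ (FV Q)))
  w∉S : w ∉ FV S
  w∉S = proj₁ (fresh-for S P (here refl))
  w∉P : w ∉ FV P
  w∉P = proj₂ (fresh-for S P (here refl))
  y∉Lδ : y ∉FΓ ctxOf Lδ
  y∉Lδ S′ P′ = y∉Δ S′ P′ ∘ All.lookup Lδ⊆Δ
  premise-renamed : (ctxOf Lδ ,, (var w , Q)) ⊢[ n ] (S [ var w / y ] , P [ var w / y ])
  premise-renamed = ⊢-mono n (⊆ₛ-trans (renameCtx-⊆ₛ y w L⊆Lδ,,y) (renameCtx-fresh w y∉Lδ y∉Q))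
                             (⊢-rename n y w (FVBelow-ctxOf L (∈⇒<fresh (FVs L))) L⊢SP)

proposition8p6 : (m n : ℕ) (Γ Δ : Ctx) (S P : Term) →
    (∀ X → X ∈ₛ Δ → Γ ⊢[ m ] X) →
    Δ ⊢[ n ] (S , P) →
    Γ ⊢[ m + n ] (S , P)
proposition8p6 m n Γ Δ S P Γ⊢Δ Δ⊢SP = subst (Γ ⊢[_] (S , P)) (+-comm n m) (cut m n Γ⊢Δ Δ⊢SP)
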